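{- Let $G=(V,E)$ be a loopless multigraph and $D$, $D'$ two $k$-connected orientations of $G$. For every $v\in V$ with $\delta^+_D(v)<\delta^+_{D'}(v)$ there exists $u\in V$ such that $\delta^+_D(u)>\delta^+_{D'}(u)$ and $(u,v)$ is flippable in $D$.
   Context: $\delta^+_D(X)$ is the number of arcs of $D$ leaving $X\subseteq V$, $\delta^+_D(v)=\delta^+_D(\{v\})$. $D$ is $k$-connected if $\delta^+_D(X)\ge k$ for all $\emptyset\ne X\subsetneq V$. $\lambda_D(u,v)$ is the maximum number of pairwise arc-disjoint directed $u$–$v$ paths. In a $k$-connected $D$, a pair $(u,v)$ of distinct vertices is flippable if $\lambda_D(u,v)>k$. -}

module Defs where

open import Data.Nat using (ℕ; suc; _≤_; _<_)
open import Data.Fin using (Fin)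
open import Data.Fin.Subset using (Subset; Nonempty; ∁; ⁅_⁆)
open import Data.Bool using (Bool; true; false; if_then_else_; _∧_; not)
open import Data.Vec using (lookup)
open import Data.List using (List; []; _∷_; length; filterᵇ; map; allFin)
open import Data.List.Relation.Unary.All using (All)
open import Data.List.Relation.Unary.AllPairs using (AllPairs)
open import Data.List.Relation.Unary.Unique.Propositional using (Unique)
open import Data.List.Relation.Binary.Disjoint.Propositional using (Disjoint)
open import Data.Product using (_×_; proj₁; proj₂; ∃)
open import Relation.Binary.PropositionalEquality using (_≡_)
open import Relation.Nullary using (¬_)

record Multigraph (n m : ℕ) : Set where
  field
    ends     : Fin m → Fin n × Fin n
    loopless : ∀ e → ¬ (proj₁ (ends e) ≡ proj₂ (ends e))

record Digraph (n m : ℕ) : Set where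
  field
    tail : Fin m → Fin n
    head : Fin m → Fin n
open Digraph public

-- An orientation of G: for each edge choose a direction.
-- true: proj₁ → proj₂, false: proj₂ → proj₁.
Orientation : ∀ {n m} → Multigraph n m → Set
Orientation {m = m} G = Fin m → Bool

orient : ∀ {n m} (G : Multigraph n m) → Orientation G → Digraph n m
orient G o = record
  { tail = λ e → if o e then proj₁ (ends e) else proj₂ (ends e)
  ; head = λ e → if o e then proj₂ (ends e) else proj₁ (ends e) }
  where open Multigraph G

δ⁺ : ∀ {n m} → Digraph n m → Subset n → ℕ
δ⁺ D X = length (filterᵇ (λ e → lookup X (tail D e) ∧ not (lookup X (head D e))) (allFin _))

δ⁺ᵥ : ∀ {n m} → Digraph n m → Fin n → ℕ
δ⁺ᵥ D v = δ⁺ D ⁅ v ⁆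

KConnected : ∀ {n m} → ℕ → Digraph n m → Set
KConnected k D = ∀ X → Nonempty X → Nonempty (∁ X) → k ≤ δ⁺ D X

data Walk {n m} (D : Digraph n m) : Fin n → Fin n → List (Fin m) → Set where
  nil  : ∀ {u} → Walk D u u []
  cons : ∀ {u v e es} → tail D e ≡ u → Walk D (head D e) v es → Walk D u v (e ∷ es)

IsPath : ∀ {n m} → Digraph n m → Fin n → Fin n → List (Fin m) → Set
IsPath D u v es = Walk D u v es × Unique (u ∷ map (head D) es)

HasDisjointPaths : ∀ {n m} → Digraph n m → Fin n → Fin n → ℕ → Set
HasDisjointPaths {m = m} D u v j =
  ∃ λ (ps : List (List (Fin m))) →
    length ps ≡ j × All (IsPath D u v) ps × AllPairs Disjoint ps

-- λ_D(u,v) > k  (λ is the maximum j with HasDisjointPaths D u v j)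
λ> : ∀ {n m} → Digraph n m → Fin n → Fin n → ℕ → Set
λ> D u v k = HasDisjointPaths D u v (suc k)

Flippable : ∀ {n m} → ℕ → Digraph n m → Fin n → Fin n → Set
Flippable k D u v = ¬ (u ≡ v) × λ> D u v k

module Submission where

-- Exchange lemma for k-connected orientations D, D′ of G, with v of smaller
-- out-degree in D.  Call X ⊆ V *tight* if v ∉ X ≠ ∅ and δ⁺_D(X) ≤ k.
--
-- Next comes Menger's theorem for arc-disjoint paths, proved by repeatedly
-- reversing paths: for each u, either λ_D(u,v) > k or some tight set
-- contains u.  Finally, by submodularity of δ⁺_D and k-connectivity,
-- intersecting tight sets have a tight union, so every finite union U of
-- tight sets still has Σ_U δ⁺_D ≤ Σ_U δ⁺_D′.  If no surplus vertex u
-- (δ⁺_D(u) > δ⁺_D′(u)) were flippable to v, tight sets would cover all of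
-- them; the complement of their union contains v and has strictly less
-- out-degree in D, contradicting Σ_V δ⁺_D = |E| = Σ_V δ⁺_D′.

open import Defs
open import Algebra.Bundles using (CommutativeMonoid)
open import Data.Nat using (ℕ; zero; suc; _+_; _*_; _≤_; _<_; _>_; z≤n; s≤s; _≤′_; ≤′-refl; ≤′-step)
open import Data.Nat.Properties hiding (_≟_)
open import Data.Fin using (Fin; zero; suc; _≟_)
open import Data.Fin.Properties using (injective⇒≤)
open import Data.Fin.Subset as Subset using (Subset; ⁅_⁆; ∁)
open import Data.Bool using (Bool; true; false; _∧_; _∨_; not; if_then_else_; _xor_)
open import Data.Bool.Properties
  using (∧-comm; ∧-zeroʳ; ∧-inverseʳ; ∧-distribˡ-∨; ∨-assoc; ∨-zeroʳ; ∨-inverseʳ; ∨-commutativeMonoid)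
open import Data.Vec using (lookup; tabulate)
open import Data.Vec.Properties using (lookup∘tabulate; lookup-map; lookup⇒[]=; lookup-replicate)
open import Data.List as List using (List; []; _∷_; length; map; filterᵇ; allFin)
open import Data.List.Properties using (length-map)
open import Data.List.Relation.Unary.All as All using (All; []; _∷_)
open import Data.List.Relation.Unary.All.Properties using (anti-mono)
open import Data.List.Relation.Unary.All.Properties.Core using (¬Any⇒All¬)
open import Data.List.Relation.Unary.Any using (here; there)
open import Data.List.Relation.Unary.AllPairs using (AllPairs; []; _∷_)
open import Data.List.Relation.Unary.Unique.Propositional using (Unique)
open import Data.List.Relation.Unary.Unique.Propositional.Properties using (map⁻)
open import Data.List.Relation.Binary.Subset.Propositional using (_⊆_)
open import Data.List.Relation.Binary.Disjoint.Propositional using (Disjoint)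
open import Data.List.Membership.Propositional using (_∈_)
open import Data.List.Membership.Propositional.Properties using (∈-lookup; ∈-allFin)
open import Data.Product using (_×_; _,_; proj₁; proj₂; ∃; Σ)
open import Data.Sum using (_⊎_; inj₁; inj₂)
open import Data.Empty using (⊥; ⊥-elim)
open import Function using (_∘_; case_of_)
open import Function.Definitions using (Injective)
open import Relation.Binary.PropositionalEquality
open import Relation.Nullary using (¬_; does; yes; no)
open import Relation.Nullary.Decidable using (dec-true)
open import Algebra.Properties.CommutativeMonoid.Sum +-0-commutativeMonoid
  using (sum; sum-cong-≗; ∑-distrib-+; ∑-comm; sum-replicate-zero)
open import Algebra.Properties.CommutativeSemigroup +-commutativeSemigroup
  using (xy∙z≈xz∙y)
open import Algebra.Properties.CommutativeSemigroup (CommutativeMonoid.commutativeSemigroup ∨-commutativeMonoid)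
  using () renaming (x∙yz≈y∙xz to ∨-left-comm)

-- Counting over finite index sets.

ind : Bool → ℕ
ind true = 1
ind false = 0

_==_ : ∀ {n} → Fin n → Fin n → Bool
x == y = does (x ≟ y)

==-sound : ∀ {n} {x y : Fin n} → x == y ≡ true → x ≡ y
==-sound {x = x} {y} h with x ≟ y
... | yes x≡y = x≡y
... | no _ = case h of λ ()

==-refl : ∀ {n} (x : Fin n) → x == x ≡ true
==-refl x = dec-true (x ≟ x) refl

∧-true : ∀ {a b} → a ∧ b ≡ true → a ≡ true × b ≡ true
∧-true {true} {true} _ = refl , refl

count : ∀ {m} → (Fin m → Bool) → ℕ
count p = sum (λ i → ind (p i))

sum-mono-≤ : ∀ {m} {f g : Fin m → ℕ} → (∀ i → f i ≤ g i) → sum f ≤ sum g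
sum-mono-≤ {zero} _ = z≤n
sum-mono-≤ {suc m} f≤g = +-mono-≤ (f≤g zero) (sum-mono-≤ (f≤g ∘ suc))

sum-mono-< : ∀ {m} {f g : Fin m → ℕ} → (∀ i → f i ≤ g i) → ∀ j → f j < g j → sum f < sum g
sum-mono-< f≤g zero fj<gj = +-mono-<-≤ fj<gj (sum-mono-≤ (f≤g ∘ suc))
sum-mono-< f≤g (suc j) fj<gj = +-mono-≤-< (f≤g zero) (sum-mono-< (f≤g ∘ suc) j fj<gj)

sum-+-cong : ∀ {m} {f g h k : Fin m → ℕ} → (∀ i → f i + g i ≡ h i + k i) → sum f + sum g ≡ sum h + sum k
sum-+-cong {f = f} {g} {h} {k} eq = trans (sym (∑-distrib-+ f g)) (trans (sum-cong-≗ eq) (∑-distrib-+ h k))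

sum-+-mono : ∀ {m} {f g h k : Fin m → ℕ} → (∀ i → f i + g i ≤ h i + k i) → sum f + sum g ≤ sum h + sum k
sum-+-mono {f = f} {g} {h} {k} le = subst₂ _≤_ (∑-distrib-+ f g) (∑-distrib-+ h k) (sum-mono-≤ le)

count-select : ∀ {m} (x : Fin m) (p : Fin m → Bool) → count (λ i → (x == i) ∧ p i) ≡ ind (p x)
count-select {suc m} zero p = trans (cong (ind (p zero) +_) (sum-replicate-zero m)) (+-identityʳ _)
count-select {suc m} (suc x) p = count-select x (p ∘ suc)

length-filter : ∀ {m} (p : Fin m → Bool) → length (filterᵇ p (allFin m)) ≡ count p
length-filter p = go p (λ i → i)
  where
  go : ∀ {A : Set} {m} (p : A → Bool) (f : Fin m → A) → length (filterᵇ p (List.tabulate f)) ≡ count (p ∘ f)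
  go {m = zero} p f = refl
  go {m = suc m} p f with p (f zero)
  ... | true = cong suc (go p (f ∘ suc))
  ... | false = go p (f ∘ suc)

existsᵇ : ∀ {m} → (Fin m → Bool) → Bool
existsᵇ {zero} p = false
existsᵇ {suc m} p = p zero ∨ existsᵇ (p ∘ suc)

existsᵇ-sound : ∀ {m} (p : Fin m → Bool) → existsᵇ p ≡ true → ∃ λ i → p i ≡ true
existsᵇ-sound {suc m} p h with p zero in p₀
... | true = zero , p₀
... | false = let (i , pᵢ) = existsᵇ-sound (p ∘ suc) h in suc i , pᵢ

existsᵇ-complete : ∀ {m} (p : Fin m → Bool) i → p i ≡ true → existsᵇ p ≡ true
existsᵇ-complete p zero pᵢ rewrite pᵢ = refl
existsᵇ-complete p (suc i) pᵢ = trans (cong (p zero ∨_) (existsᵇ-complete (p ∘ suc) i pᵢ)) (∨-zeroʳ (p zero))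

existsᵇ-false : ∀ {m} (p : Fin m → Bool) → existsᵇ p ≡ false → ∀ i → p i ≡ false
existsᵇ-false p none i with p i in pᵢ
... | false = refl
... | true = case trans (sym none) (existsᵇ-complete p i pᵢ) of λ ()

-- Degrees, cuts and the degree-sum identity.
--
-- Vertex sets are boolean predicates X : Fin n → Bool.

module _ {n m : ℕ} (D : Digraph n m) where

  outdeg : Fin n → ℕ
  outdeg w = count (λ e → tail D e == w)

  tailsIn : (Fin n → Bool) → ℕ
  tailsIn X = count (λ e → X (tail D e))

  inner : (Fin n → Bool) → ℕ
  inner X = count (λ e → X (tail D e) ∧ X (head D e))

  cut : (Fin n → Bool) → ℕ
  cut X = count (λ e → X (tail D e) ∧ not (X (head D e)))

  tailsIn-split : ∀ X → tailsIn X ≡ inner X + cut X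
  tailsIn-split X =
    trans (sum-cong-≗ (λ e → split (X (tail D e)) (X (head D e))))
          (∑-distrib-+ (λ e → ind (X (tail D e) ∧ X (head D e))) (λ e → ind (X (tail D e) ∧ not (X (head D e)))))
    where
    split : ∀ a b → ind a ≡ ind (a ∧ b) + ind (a ∧ not b)
    split true true = refl
    split true false = refl
    split false _ = refl

  degree-sum : ∀ X → tailsIn X ≡ sum (λ w → if X w then outdeg w else 0)
  degree-sum X = begin
      sum (λ e → ind (X (tail D e)))
    ≡⟨ sum-cong-≗ (λ e → sym (count-select (tail D e) X)) ⟩
      sum (λ e → count (λ w → (tail D e == w) ∧ X w))
    ≡⟨ sum-cong-≗ (λ e → sum-cong-≗ (λ w → cong ind (∧-comm (tail D e == w) (X w)))) ⟩
      sum (λ e → count (λ w → X w ∧ (tail D e == w)))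
    ≡⟨ ∑-comm (λ e w → ind (X w ∧ (tail D e == w))) ⟩
      sum (λ w → count (λ e → X w ∧ (tail D e == w)))
    ≡⟨ sum-cong-≗ (λ w → restrict (X w)) ⟩
      sum (λ w → if X w then outdeg w else 0) ∎
    where
    open ≡-Reasoning
    restrict : ∀ {w} b → count (λ e → b ∧ (tail D e == w)) ≡ (if b then outdeg w else 0)
    restrict true = refl
    restrict false = sum-replicate-zero m

  tailsIn-cong : ∀ {X Y} → (∀ w → X w ≡ Y w) → tailsIn X ≡ tailsIn Y
  tailsIn-cong X≗Y = sum-cong-≗ (λ e → cong ind (X≗Y (tail D e)))

  tailsIn-disjoint : ∀ X Y → (∀ w → X w ∧ Y w ≡ false) → tailsIn (λ w → X w ∨ Y w) ≡ tailsIn X + tailsIn Y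
  tailsIn-disjoint X Y disjoint =
    trans (sum-cong-≗ per-arc) (∑-distrib-+ (λ e → ind (X (tail D e))) (λ e → ind (Y (tail D e))))
    where
    per-arc : ∀ e → ind (X (tail D e) ∨ Y (tail D e)) ≡ ind (X (tail D e)) + ind (Y (tail D e))
    per-arc e with X (tail D e) | Y (tail D e) | disjoint (tail D e)
    ... | true | false | _ = refl
    ... | false | _ | _ = refl

  cut-cong : ∀ {X Y} → (∀ w → X w ≡ Y w) → cut X ≡ cut Y
  cut-cong X≗Y = sum-cong-≗ (λ e → cong₂ (λ a b → ind (a ∧ not b)) (X≗Y (tail D e)) (X≗Y (head D e)))

  cut-submodular : ∀ X Y → cut (λ w → X w ∨ Y w) + cut (λ w → X w ∧ Y w) ≤ cut X + cut Y
  cut-submodular X Y = sum-+-mono {m} (λ e → per-arc (X (tail D e)) (Y (tail D e)) (X (head D e)) (Y (head D e)))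
    where
    per-arc : ∀ x y x′ y′ →
      ind ((x ∨ y) ∧ not (x′ ∨ y′)) + ind ((x ∧ y) ∧ not (x′ ∧ y′)) ≤ ind (x ∧ not x′) + ind (y ∧ not y′)
    per-arc true  true  true  true  = z≤n
    per-arc true  true  true  false = s≤s z≤n
    per-arc true  true  false true  = s≤s z≤n
    per-arc true  true  false false = s≤s (s≤s z≤n)
    per-arc true  false true  _     = z≤n
    per-arc true  false false true  = z≤n
    per-arc true  false false false = s≤s z≤n
    per-arc false true  true  _     = z≤n
    per-arc false true  false true  = z≤n
    per-arc false true  false false = s≤s z≤n
    per-arc false false _     _     = z≤n

  δ⁺-cut : ∀ S → δ⁺ D S ≡ cut (lookup S)
  δ⁺-cut S = length-filter (λ e → lookup S (tail D e) ∧ not (lookup S (head D e)))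

  cut-bound : ∀ {k} → KConnected k D → ∀ X → (∃ λ w → X w ≡ true) → (∃ λ w → X w ≡ false) → k ≤ cut X
  cut-bound {k} conn X (w₁ , Xw₁) (w₂ , ¬Xw₂) =
    subst (k ≤_) (trans (δ⁺-cut S) (cut-cong (lookup∘tabulate X))) (conn S (w₁ , w₁∈S) (w₂ , w₂∈∁S))
    where
    S : Subset n
    S = tabulate X
    w₁∈S : w₁ Subset.∈ S
    w₁∈S = lookup⇒[]= w₁ S (trans (lookup∘tabulate X w₁) Xw₁)
    w₂∈∁S : w₂ Subset.∈ ∁ S
    w₂∈∁S = lookup⇒[]= w₂ (∁ S) (trans (lookup-map w₂ not S) (cong not (trans (lookup∘tabulate X w₂) ¬Xw₂)))

exit-blocked : ∀ a b → (a ≡ true → b ≡ true) → ind (a ∧ not b) ≡ 0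
exit-blocked false b _ = refl
exit-blocked true b a⇒b rewrite a⇒b refl = refl

closed-cut : ∀ {n m} (D : Digraph n m) (R : Fin n → Bool) →
  (∀ e → R (tail D e) ≡ true → R (head D e) ≡ true) → cut D R ≡ 0
closed-cut {m = m} D R closed =
  trans (sum-cong-≗ (λ e → exit-blocked (R (tail D e)) (R (head D e)) (closed e))) (sum-replicate-zero m)

lookup-singleton : ∀ {n} (w x : Fin n) → lookup ⁅ w ⁆ x ≡ x == w
lookup-singleton zero zero = refl
lookup-singleton zero (suc x) = lookup-replicate x false
lookup-singleton (suc w) zero = refl
lookup-singleton (suc w) (suc x) = lookup-singleton w x

module _ {n m : ℕ} (G : Multigraph n m) where
  open Multigraph G

  orient-loopless : ∀ o e → ¬ (tail (orient G o) e ≡ head (orient G o) e)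
  orient-loopless o e with o e
  ... | true = loopless e
  ... | false = loopless e ∘ sym

  -- Since G is loopless, δ⁺_D(v) of Defs is the number of arcs with tail v.
  δ⁺ᵥ-outdeg : ∀ o w → δ⁺ᵥ (orient G o) w ≡ outdeg (orient G o) w
  δ⁺ᵥ-outdeg o w = trans (δ⁺-cut D ⁅ w ⁆) (trans (cut-cong D (lookup-singleton w)) (sum-cong-≗ {m} leaves))
    where
    D : Digraph n m
    D = orient G o
    leaves : ∀ e → ind ((tail D e == w) ∧ not (head D e == w)) ≡ ind (tail D e == w)
    leaves e with tail D e ≟ w | head D e ≟ w
    ... | yes refl | yes h≡w = ⊥-elim (orient-loopless o e (sym h≡w))
    ... | yes _ | no _ = refl
    ... | no _ | _ = refl

  -- Both orientations see the same pairs of ends, so arcs inside X do not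
  -- depend on the orientation.
  inner-orient : ∀ o o′ X → inner (orient G o) X ≡ inner (orient G o′) X
  inner-orient o o′ X = sum-cong-≗ same-ends
    where
    same-ends : ∀ e → ind (X (tail (orient G o) e) ∧ X (head (orient G o) e))
                    ≡ ind (X (tail (orient G o′) e) ∧ X (head (orient G o′) e))
    same-ends e with o e | o′ e
    ... | true | true = refl
    ... | false | false = refl
    ... | true | false = cong ind (∧-comm (X (proj₁ (ends e))) _)
    ... | false | true = cong ind (∧-comm (X (proj₂ (ends e))) _)

-- Walks, paths and reachability.

lookup-injective : ∀ {A : Set} {xs : List A} → Unique xs → Injective _≡_ _≡_ (List.lookup xs)
lookup-injective (_ ∷ _) {zero} {zero} _ = refl
lookup-injective (x∉xs ∷ _) {zero} {suc j} x≡xⱼ = ⊥-elim (All.lookup x∉xs (∈-lookup j) x≡xⱼ)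
lookup-injective (x∉xs ∷ _) {suc i} {zero} xᵢ≡x = ⊥-elim (All.lookup x∉xs (∈-lookup i) (sym xᵢ≡x))
lookup-injective (_ ∷ u) {suc i} {suc j} xᵢ≡xⱼ = cong suc (lookup-injective u xᵢ≡xⱼ)

unique-length : ∀ {n} {xs : List (Fin n)} → Unique xs → length xs ≤ n
unique-length u = injective⇒≤ (lookup-injective u)

module _ {n m : ℕ} (D : Digraph n m) where
  open import Data.List.Membership.DecPropositional (_≟_ {n}) using (_∈?_)

  path-length : ∀ {x t es} → IsPath D x t es → length es < n
  path-length {x} {es = es} (_ , distinct) =
    ≤-trans (s≤s (≤-reflexive (sym (length-map (head D) es)))) (unique-length distinct)

  suffix-path : ∀ {x t es} → IsPath D x t es → ∀ {y} → y ∈ (x ∷ map (head D) es) →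
                ∃ λ es′ → IsPath D y t es′ × es′ ⊆ es
  suffix-path p (here refl) = _ , p , λ e∈ → e∈
  suffix-path (cons _ w , _ ∷ distinct) (there y∈) =
    let (es′ , p′ , es′⊆) = suffix-path (w , distinct) y∈ in es′ , p′ , there ∘ es′⊆

  shortcut : ∀ {x t es} → Walk D x t es → ∃ λ es′ → IsPath D x t es′ × es′ ⊆ es
  shortcut nil = [] , (nil , [] ∷ []) , λ ()
  shortcut {x} (cons {e = e} tail≡x w) with shortcut w
  ... | es″ , (w″ , distinct″) , es″⊆ with x ∈? (head D e ∷ map (head D) es″)
  ...   | yes x∈ = let (es′ , p′ , es′⊆) = suffix-path (w″ , distinct″) x∈ in es′ , p′ , there ∘ es″⊆ ∘ es′⊆
  ...   | no x∉ = e ∷ es″ , (cons tail≡x w″ , ¬Any⇒All¬ _ x∉ ∷ distinct″) ,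
                  λ { (here e≡) → here e≡ ; (there e∈) → there (es″⊆ e∈) }

module Reachability {n m : ℕ} (D : Digraph n m) (allowed : Fin m → Bool) (t : Fin n) where

  Allowed : List (Fin m) → Set
  Allowed = All (λ e → allowed e ≡ true)

  reaches : ℕ → Fin n → Bool
  reaches zero w = w == t
  reaches (suc i) w = reaches i w ∨ existsᵇ (λ e → allowed e ∧ ((tail D e == w) ∧ reaches i (head D e)))

  reaches-mono : ∀ {i j} w → i ≤ j → reaches i w ≡ true → reaches j w ≡ true
  reaches-mono w i≤j = go (≤⇒≤′ i≤j)
    where
    go : ∀ {i j} → i ≤′ j → reaches i w ≡ true → reaches j w ≡ true
    go ≤′-refl r = r
    go (≤′-step i≤′j) r rewrite go i≤′j r = refl

  reaches-target : ∀ i → reaches i t ≡ true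
  reaches-target i = reaches-mono {0} {i} t z≤n (==-refl t)

  reaches-sound : ∀ i w → reaches i w ≡ true → ∃ λ es → Walk D w t es × Allowed es
  reaches-sound zero w r with ==-sound {x = w} {t} r
  ... | refl = [] , nil , []
  reaches-sound (suc i) w r with reaches i w in rᵢ
  ... | true = reaches-sound i w rᵢ
  ... | false with existsᵇ-sound _ r
  ...   | e , r′ with ∧-true r′
  ...     | ok , r″ with ∧-true r″
  ...       | tail≡w , rₕ with reaches-sound i (head D e) rₕ
  ...         | es , w′ , ok* = e ∷ es , cons (==-sound tail≡w) w′ , ok ∷ ok*

  reaches-complete : ∀ i {w es} → Walk D w t es → Allowed es → length es ≤ i → reaches i w ≡ true
  reaches-complete i nil _ _ = reaches-target i
  reaches-complete (suc i) (cons {e = e} refl w) (ok ∷ ok*) (s≤s len≤i) =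
    trans (cong (reaches i (tail D e) ∨_) (existsᵇ-complete _ e step)) (∨-zeroʳ _)
    where
    step : allowed e ∧ ((tail D e == tail D e) ∧ reaches i (head D e)) ≡ true
    step rewrite ok | ==-refl (tail D e) = reaches-complete i w ok* len≤i

  -- After n rounds the iteration is saturated: since paths have fewer than
  -- n arcs, reaching t is closed under stepping back along allowed arcs.
  reaches-closed : ∀ e → allowed e ≡ true → reaches n (head D e) ≡ true → reaches n (tail D e) ≡ true
  reaches-closed e ok r with reaches-sound n (head D e) r
  ... | es , w , ok* with shortcut D (cons {e = e} refl w)
  ...   | es′ , p , es′⊆ =
          reaches-complete n (proj₁ p) (anti-mono es′⊆ (ok ∷ ok*)) (≤-trans (n≤1+n _) (path-length D p))

  reach : ∀ x → (∃ λ es → IsPath D x t es × Allowed es)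
              ⊎ (∃ λ (R : Fin n → Bool) → R x ≡ true × R t ≡ false ×
                   (∀ e → allowed e ≡ true → R (tail D e) ≡ true → R (head D e) ≡ true))
  reach x with reaches n x in rₓ
  ... | true = let (es , w , ok*) = reaches-sound n x rₓ
                   (es′ , p , es′⊆) = shortcut D w
               in inj₁ (es′ , p , anti-mono es′⊆ ok*)
  ... | false = inj₂ (not ∘ reaches n , cong not rₓ , cong not (reaches-target n) , closed)
    where
    closed : ∀ e → allowed e ≡ true → not (reaches n (tail D e)) ≡ true → not (reaches n (head D e)) ≡ true
    closed e ok ¬rₜ with reaches n (head D e) in rₕ
    ... | false = refl
    ... | true rewrite reaches-closed e ok rₕ = ¬rₜ

-- Reversing a path.

mem : ∀ {m} → List (Fin m) → Fin m → Bool
mem [] e = false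
mem (x ∷ xs) e = (x == e) ∨ mem xs e

mem-complete : ∀ {m} {xs : List (Fin m)} {e} → e ∈ xs → mem xs e ≡ true
mem-complete {xs = x ∷ _} (here refl) rewrite ==-refl x = refl
mem-complete {xs = x ∷ _} (there e∈) rewrite mem-complete e∈ = ∨-zeroʳ (x == _)

mem-sound : ∀ {m} (xs : List (Fin m)) {e} → mem xs e ≡ true → e ∈ xs
mem-sound (x ∷ xs) {e} h with x ≟ e
... | yes refl = here refl
... | no _ = there (mem-sound xs h)

mem-absent : ∀ {m} {x : Fin m} {xs} → All (λ y → ¬ x ≡ y) xs → mem xs x ≡ false
mem-absent [] = refl
mem-absent {x = x} {y ∷ _} (x≢y ∷ x∉) with y ≟ x
... | yes refl = ⊥-elim (x≢y refl)
... | no _ = mem-absent x∉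

countList : ∀ {A : Set} → (A → Bool) → List A → ℕ
countList q [] = 0
countList q (x ∷ xs) = ind (q x) + countList q xs

count-mem : ∀ {m} {es : List (Fin m)} → Unique es → ∀ q → count (λ e → mem es e ∧ q e) ≡ countList q es
count-mem {m} [] q = sum-replicate-zero m
count-mem {es = x ∷ es} (x∉es ∷ distinct) q = begin
    count (λ e → ((x == e) ∨ mem es e) ∧ q e)
  ≡⟨ sum-cong-≗ split ⟩
    sum (λ e → ind ((x == e) ∧ q e) + ind (mem es e ∧ q e))
  ≡⟨ ∑-distrib-+ (λ e → ind ((x == e) ∧ q e)) (λ e → ind (mem es e ∧ q e)) ⟩
    count (λ e → (x == e) ∧ q e) + count (λ e → mem es e ∧ q e)
  ≡⟨ cong₂ _+_ (count-select x q) (count-mem distinct q) ⟩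
    ind (q x) + countList q es ∎
  where
  open ≡-Reasoning
  split : ∀ e → ind (((x == e) ∨ mem es e) ∧ q e) ≡ ind ((x == e) ∧ q e) + ind (mem es e ∧ q e)
  split e with x ≟ e
  ... | yes refl rewrite mem-absent x∉es = sym (+-identityʳ _)
  ... | no _ = refl

walk-telescope : ∀ {n m} (D : Digraph n m) (R : Fin n → Bool) {u v es} → Walk D u v es →
  countList (R ∘ tail D) es + ind (R v) ≡ countList (R ∘ head D) es + ind (R u)
walk-telescope D R nil = refl
walk-telescope D R {v = v} (cons {e = e} {es = es} refl w) = begin
    (ind (R (tail D e)) + countList (R ∘ tail D) es) + ind (R v)
  ≡⟨ +-assoc (ind (R (tail D e))) _ _ ⟩
    ind (R (tail D e)) + (countList (R ∘ tail D) es + ind (R v))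
  ≡⟨ cong (ind (R (tail D e)) +_) (walk-telescope D R w) ⟩
    ind (R (tail D e)) + (countList (R ∘ head D) es + ind (R (head D e)))
  ≡⟨ +-comm (ind (R (tail D e))) _ ⟩
    (countList (R ∘ head D) es + ind (R (head D e))) + ind (R (tail D e))
  ≡⟨ cong (_+ ind (R (tail D e))) (+-comm (countList (R ∘ head D) es) _) ⟩
    (ind (R (head D e)) + countList (R ∘ head D) es) + ind (R (tail D e)) ∎
  where open ≡-Reasoning

module _ {n m : ℕ} (G : Multigraph n m) where

  reverse : Orientation G → (Fin m → Bool) → Orientation G
  reverse o S e = if S e then not (o e) else o e

  tail-reverse : ∀ o S e → tail (orient G (reverse o S)) e ≡ (if S e then head (orient G o) e else tail (orient G o) e)
  tail-reverse o S e with S e | o e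
  ... | true | true = refl
  ... | true | false = refl
  ... | false | _ = refl

  reverse-tailsIn : ∀ o S R →
    tailsIn (orient G (reverse o S)) R + count (λ e → S e ∧ R (tail (orient G o) e))
      ≡ tailsIn (orient G o) R + count (λ e → S e ∧ R (head (orient G o) e))
  reverse-tailsIn o S R = sum-+-cong {m} per-arc
    where
    D : Digraph n m
    D = orient G o
    per-arc : ∀ e → ind (R (tail (orient G (reverse o S)) e)) + ind (S e ∧ R (tail D e))
                  ≡ ind (R (tail D e)) + ind (S e ∧ R (head D e))
    per-arc e rewrite tail-reverse o S e with S e
    ... | true = +-comm (ind (R (head D e))) _
    ... | false = refl

  -- Reversing a u–v path moves one unit of out-degree from u to v: for every
  -- vertex set R the number of arcs with tail in R changes by [R v] − [R u].
  reverse-path : ∀ o {u v es} → IsPath (orient G o) u v es → ∀ R →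
    tailsIn (orient G (reverse o (mem es))) R + ind (R u) ≡ tailsIn (orient G o) R + ind (R v)
  reverse-path o {u} {v} {es} (w , _ ∷ distinct) R = +-cancelʳ-≡ a _ _ (begin
      (T′ + ind (R u)) + a  ≡⟨ xy∙z≈xz∙y T′ _ a ⟩
      (T′ + a) + ind (R u)  ≡⟨ cong (_+ ind (R u)) (trans (cong (T′ +_) (sym (count-mem arcs (R ∘ tail D))))
                                                          (reverse-tailsIn o (mem es) R)) ⟩
      (T + count (λ e → mem es e ∧ R (head D e))) + ind (R u)
                            ≡⟨ cong (λ z → (T + z) + ind (R u)) (count-mem arcs (R ∘ head D)) ⟩
      (T + b) + ind (R u)   ≡⟨ +-assoc T b _ ⟩
      T + (b + ind (R u))   ≡⟨ cong (T +_) (sym (walk-telescope D R w)) ⟩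
      T + (a + ind (R v))   ≡⟨ cong (T +_) (+-comm a _) ⟩
      T + (ind (R v) + a)   ≡⟨ sym (+-assoc T _ a) ⟩
      (T + ind (R v)) + a   ∎)
    where
    open ≡-Reasoning
    D : Digraph n m
    D = orient G o
    arcs : Unique es
    arcs = map⁻ distinct
    T T′ a b : ℕ
    T′ = tailsIn (orient G (reverse o (mem es))) R
    T = tailsIn D R
    a = countList (R ∘ tail D) es
    b = countList (R ∘ head D) es

-- Menger's theorem for arc-disjoint paths, by path reversal.

module _ {n m : ℕ} {D D′ : Digraph n m} where

  SameArc : Fin m → Set
  SameArc e = tail D e ≡ tail D′ e × head D e ≡ head D′ e

  walk-transfer : ∀ {x y p} → All SameArc p → Walk D x y p → Walk D′ x y p
  walk-transfer [] nil = nil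
  walk-transfer {y = y} ((t≡ , h≡) ∷ same) (cons refl w) =
    cons (sym t≡) (subst (λ z → Walk D′ z y _) h≡ (walk-transfer same w))

  heads-transfer : ∀ {p} → All SameArc p → map (head D) p ≡ map (head D′) p
  heads-transfer [] = refl
  heads-transfer ((_ , h≡) ∷ same) = cong₂ _∷_ h≡ (heads-transfer same)

  path-transfer : ∀ {x y p} → All SameArc p → IsPath D x y p → IsPath D′ x y p
  path-transfer {x} same (w , distinct) =
    walk-transfer same w , subst (λ hs → Unique (x ∷ hs)) (heads-transfer same) distinct

module _ {n m : ℕ} (G : Multigraph n m) where
  open Multigraph G

  -- o′ is reached from o by moving c units of out-degree from u to v, seen
  -- through every vertex set R.  This is exactly what reversing c
  -- arc-disjoint u–v paths does.
  Balanced : Orientation G → Orientation G → Fin n → Fin n → ℕ → Set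
  Balanced o o′ u v c = ∀ R → tailsIn (orient G o) R + c * ind (R v) ≡ tailsIn (orient G o′) R + c * ind (R u)

  balanced-refl : ∀ o u v → Balanced o o u v 0
  balanced-refl o u v R = refl

  balanced-trans : ∀ {o o₁ o₂ u v a b} → Balanced o o₁ u v a → Balanced o₁ o₂ u v b → Balanced o o₂ u v (a + b)
  balanced-trans {o} {o₁} {o₂} {u} {v} {a} {b} bal₁ bal₂ R = begin
      T₀ + (a + b) * y     ≡⟨ cong (T₀ +_) (*-distribʳ-+ y a b) ⟩
      T₀ + (a * y + b * y) ≡⟨ sym (+-assoc T₀ _ _) ⟩
      (T₀ + a * y) + b * y ≡⟨ cong (_+ b * y) (bal₁ R) ⟩
      (T₁ + a * x) + b * y ≡⟨ xy∙z≈xz∙y T₁ _ _ ⟩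
      (T₁ + b * y) + a * x ≡⟨ cong (_+ a * x) (bal₂ R) ⟩
      (T₂ + b * x) + a * x ≡⟨ xy∙z≈xz∙y T₂ _ _ ⟩
      (T₂ + a * x) + b * x ≡⟨ +-assoc T₂ _ _ ⟩
      T₂ + (a * x + b * x) ≡⟨ cong (T₂ +_) (sym (*-distribʳ-+ x a b)) ⟩
      T₂ + (a + b) * x     ∎
    where
    open ≡-Reasoning
    T₀ T₁ T₂ x y : ℕ
    T₀ = tailsIn (orient G o) R
    T₁ = tailsIn (orient G o₁) R
    T₂ = tailsIn (orient G o₂) R
    x = ind (R u)
    y = ind (R v)

  balanced-cancel : ∀ {o o₁ o₂ u v a b} → Balanced o o₁ u v a → Balanced o o₂ u v (a + b) → Balanced o₁ o₂ u v b
  balanced-cancel {o} {o₁} {o₂} {u} {v} {a} {b} bal₁ bal₂ R = +-cancelʳ-≡ (a * x) _ _ (begin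
      (T₁ + b * y) + a * x ≡⟨ xy∙z≈xz∙y T₁ _ _ ⟩
      (T₁ + a * x) + b * y ≡⟨ cong (_+ b * y) (sym (bal₁ R)) ⟩
      (T₀ + a * y) + b * y ≡⟨ +-assoc T₀ _ _ ⟩
      T₀ + (a * y + b * y) ≡⟨ cong (T₀ +_) (sym (*-distribʳ-+ y a b)) ⟩
      T₀ + (a + b) * y     ≡⟨ bal₂ R ⟩
      T₂ + (a + b) * x     ≡⟨ cong (T₂ +_) (*-distribʳ-+ x a b) ⟩
      T₂ + (a * x + b * x) ≡⟨ sym (+-assoc T₂ _ _) ⟩
      (T₂ + a * x) + b * x ≡⟨ xy∙z≈xz∙y T₂ _ _ ⟩
      (T₂ + b * x) + a * x ∎)
    where
    open ≡-Reasoning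
    T₀ T₁ T₂ x y : ℕ
    T₀ = tailsIn (orient G o) R
    T₁ = tailsIn (orient G o₁) R
    T₂ = tailsIn (orient G o₂) R
    x = ind (R u)
    y = ind (R v)

  balanced-reverse : ∀ o {u v es} → IsPath (orient G o) u v es → Balanced o (reverse G o (mem es)) u v 1
  balanced-reverse o {u} {v} {es} p R = begin
      T + 1 * ind (R v)  ≡⟨ cong (T +_) (*-identityˡ (ind (R v))) ⟩
      T + ind (R v)      ≡⟨ sym (reverse-path G o p R) ⟩
      T′ + ind (R u)     ≡⟨ cong (T′ +_) (sym (*-identityˡ (ind (R u)))) ⟩
      T′ + 1 * ind (R u) ∎
    where
    open ≡-Reasoning
    T T′ : ℕ
    T = tailsIn (orient G o) R
    T′ = tailsIn (orient G (reverse G o (mem es))) R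

  balanced-cut : ∀ {o o′ u v c} → Balanced o o′ u v c → ∀ R → R u ≡ true → R v ≡ false →
    cut (orient G o) R ≡ cut (orient G o′) R + c
  balanced-cut {o} {o′} {u} {v} {c} bal R Ru Rv = +-cancelˡ-≡ I _ _ (begin
      I + C                 ≡⟨ sym (tailsIn-split D R) ⟩
      T                     ≡⟨ sym (+-identityʳ T) ⟩
      T + 0                 ≡⟨ cong (T +_) (sym (*-zeroʳ c)) ⟩
      T + c * 0             ≡⟨ cong (λ b → T + c * ind b) (sym Rv) ⟩
      T + c * ind (R v)     ≡⟨ bal R ⟩
      T′ + c * ind (R u)    ≡⟨ cong (λ b → T′ + c * ind b) Ru ⟩
      T′ + c * 1            ≡⟨ cong₂ _+_ (tailsIn-split D′ R) (*-identityʳ c) ⟩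
      (I′ + C′) + c         ≡⟨ cong (λ z → (z + C′) + c) (inner-orient G o′ o R) ⟩
      (I + C′) + c          ≡⟨ +-assoc I C′ c ⟩
      I + (C′ + c)          ∎)
    where
    open ≡-Reasoning
    D D′ : Digraph n m
    D = orient G o
    D′ = orient G o′
    T T′ I I′ C C′ : ℕ
    T = tailsIn D R
    T′ = tailsIn D′ R
    I = inner D R
    I′ = inner D′ R
    C = cut D R
    C′ = cut D′ R

  augment : ∀ {o o₁ u v c} → Balanced o o₁ u v c →
    (∃ λ o₂ → Balanced o o₂ u v (c + 1)) ⊎ (∃ λ R → R u ≡ true × R v ≡ false × cut (orient G o) R ≡ c)
  augment {o} {o₁} {u} {v} {c} bal with Reachability.reach (orient G o₁) (λ _ → true) v u
  ... | inj₁ (_ , p , _) = inj₁ (_ , balanced-trans {a = c} {b = 1} bal (balanced-reverse o₁ p))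
  ... | inj₂ (R , Ru , Rv , closed) = inj₂ (R , Ru , Rv ,
          trans (balanced-cut bal R Ru Rv) (cong (λ z → z + c) (closed-cut (orient G o₁) R (λ e → closed e refl))))

  iterate : ∀ o u v j → (∃ λ o′ → Balanced o o′ u v j) ⊎ (∃ λ R → R u ≡ true × R v ≡ false × cut (orient G o) R < j)
  iterate o u v zero = inj₁ (o , balanced-refl o u v)
  iterate o u v (suc j) with iterate o u v j
  ... | inj₂ (R , Ru , Rv , small) = inj₂ (R , Ru , Rv , m<n⇒m<1+n small)
  ... | inj₁ (o₁ , bal) with augment bal
  ...   | inj₁ (o₂ , bal′) = inj₁ (o₂ , subst (Balanced o o₂ u v) (+-comm j 1) bal′)
  ...   | inj₂ (R , Ru , Rv , ≡j) = inj₂ (R , Ru , Rv , ≤-reflexive (cong suc ≡j))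

  Differs : Orientation G → Orientation G → Fin m → Bool
  Differs o o′ e = o e xor o′ e

  cut-closed-≤ : ∀ o o′ R → (∀ e → Differs o o′ e ≡ true → R (tail (orient G o) e) ≡ true → R (head (orient G o) e) ≡ true) →
    cut (orient G o) R ≤ cut (orient G o′) R
  cut-closed-≤ o o′ R closed = sum-mono-≤ per-arc
    where
    per-arc : ∀ e → ind (R (tail (orient G o) e) ∧ not (R (head (orient G o) e)))
                  ≤ ind (R (tail (orient G o′) e) ∧ not (R (head (orient G o′) e)))
    per-arc e with o e | o′ e | closed e
    ... | true | true | _ = ≤-refl
    ... | false | false | _ = ≤-refl
    ... | true | false | closedₑ = ≤-trans (≤-reflexive (exit-blocked _ _ (closedₑ refl))) z≤n
    ... | false | true | closedₑ = ≤-trans (≤-reflexive (exit-blocked _ _ (closedₑ refl))) z≤n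

  PathSystem : Orientation G → Orientation G → Fin n → Fin n → ℕ → Set
  PathSystem o o′ u v c = ∃ λ ps → length ps ≡ c × All (IsPath (orient G o) u v) ps × AllPairs Disjoint ps
                                  × All (All (λ e → Differs o o′ e ≡ true)) ps

  off-path : ∀ {o o′ es e} → All (λ e → Differs o o′ e ≡ true) es →
    Differs (reverse G o (mem es)) o′ e ≡ true → mem es e ≡ false
  off-path {o} {o′} {es} {e} on-es differs with mem es e in e∈es
  ... | false = refl
  ... | true with All.lookup on-es (mem-sound es e∈es)
  ...   | differed-before with o e | o′ e
  ...     | true | false = case differs of λ ()
  ...     | false | true = case differs of λ ()

  orient-agree : ∀ {o o₁ e} → o₁ e ≡ o e → SameArc {D = orient G o₁} {orient G o} e
  orient-agree {e = e} eq =
    cong (λ b → if b then proj₁ (ends e) else proj₂ (ends e)) eq ,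
    cong (λ b → if b then proj₂ (ends e) else proj₁ (ends e)) eq

  extend-system : ∀ {o o′ u v c es} → IsPath (orient G o) u v es → All (λ e → Differs o o′ e ≡ true) es →
    PathSystem (reverse G o (mem es)) o′ u v c → PathSystem o o′ u v (suc c)
  extend-system {o} {o′} {u} {v} {es = es} p on-es (ps , len , paths , disjoint , diffs) =
    es ∷ ps , cong suc len , p ∷ All.zipWith moved (paths , diffs) ,
    All.map fresh diffs ∷ disjoint , on-es ∷ All.map (All.map still-differs) diffs
    where
    o₁ : Orientation G
    o₁ = reverse G o (mem es)
    unchanged : ∀ {e} → Differs o₁ o′ e ≡ true → o₁ e ≡ o e
    unchanged {e} d rewrite off-path {o} {o′} on-es d = refl
    still-differs : ∀ {e} → Differs o₁ o′ e ≡ true → Differs o o′ e ≡ true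
    still-differs {e} d = trans (cong (_xor o′ e) (sym (unchanged d))) d
    moved : ∀ {q} → IsPath (orient G o₁) u v q × All (λ e → Differs o₁ o′ e ≡ true) q → IsPath (orient G o) u v q
    moved (path , d) = path-transfer (All.map (λ {e} d′ → orient-agree {o} {o₁} {e} (unchanged d′)) d) path
    fresh : ∀ {q} → All (λ e → Differs o₁ o′ e ≡ true) q → Disjoint es q
    fresh d (e∈es , e∈q) = case trans (sym (mem-complete e∈es)) (off-path {o} {o′} on-es (All.lookup d e∈q)) of λ ()

  decompose : ∀ c o o′ u v → Balanced o o′ u v c → PathSystem o o′ u v c
  decompose zero o o′ u v _ = [] , refl , [] , [] , []
  decompose (suc c) o o′ u v bal with Reachability.reach (orient G o) (Differs o o′) v u
  ... | inj₁ (es , p , on-es) =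
        extend-system p on-es (decompose c _ o′ u v (balanced-cancel {a = 1} {b = c} (balanced-reverse o p) bal))
  ... | inj₂ (R , Ru , Rv , closed) = ⊥-elim (m+1+n≰m C′ (begin
        C′ + suc c          ≡⟨ balanced-cut bal R Ru Rv ⟨
        cut (orient G o) R  ≤⟨ cut-closed-≤ o o′ R closed ⟩
        C′                  ∎))
    where
    open ≤-Reasoning
    C′ : ℕ
    C′ = cut (orient G o′) R

  menger : ∀ k o u v → HasDisjointPaths (orient G o) u v (suc k)
                     ⊎ (∃ λ R → R u ≡ true × R v ≡ false × cut (orient G o) R ≤ k)
  menger k o u v with iterate o u v (suc k)
  ... | inj₂ (R , Ru , Rv , s≤s small) = inj₂ (R , Ru , Rv , small)
  ... | inj₁ (o′ , bal) with decompose (suc k) o o′ u v bal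
  ...   | ps , len , paths , disjoint , _ = inj₁ (ps , len , paths , disjoint)

-- Tight sets and the exchange argument.

module Exchange {n m : ℕ} (k : ℕ) (G : Multigraph n m) (o o′ : Orientation G)
  (conn : KConnected k (orient G o)) (conn′ : KConnected k (orient G o′)) (v : Fin n) where

  D D′ : Digraph n m
  D = orient G o
  D′ = orient G o′

  record Tight : Set where
    field
      set    : Fin n → Bool
      avoids : set v ≡ false
      member : ∃ λ w → set w ≡ true
      small  : cut D set ≤ k
  open Tight

  tight-excess : ∀ X → tailsIn D (set X) ≤ tailsIn D′ (set X)
  tight-excess X = begin
      tailsIn D (set X)                  ≡⟨ tailsIn-split D (set X) ⟩
      inner D (set X) + cut D (set X)    ≤⟨ +-monoʳ-≤ (inner D (set X)) D-cut≤D′-cut ⟩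
      inner D (set X) + cut D′ (set X)   ≡⟨ cong (_+ cut D′ (set X)) (inner-orient G o o′ (set X)) ⟩
      inner D′ (set X) + cut D′ (set X)  ≡⟨ tailsIn-split D′ (set X) ⟨
      tailsIn D′ (set X)                 ∎
    where
    open ≤-Reasoning
    D-cut≤D′-cut : cut D (set X) ≤ cut D′ (set X)
    D-cut≤D′-cut = ≤-trans (small X) (cut-bound D′ conn′ (set X) (member X) (v , avoids X))

  Meet : Tight → Tight → Set
  Meet A B = ∃ λ w → set A w ∧ set B w ≡ true

  -- Uncrossing: intersecting tight sets have a tight union, because their
  -- intersection still avoids v and so is left by at least k arcs.
  tight-union : ∀ A B → Meet A B → Tight
  tight-union A B meet = record
    { set = A∪B
    ; avoids = cong₂ _∨_ (avoids A) (avoids B)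
    ; member = let (w , Aw) = member A in w , cong (_∨ set B w) Aw
    ; small = +-cancelʳ-≤ k _ _ (begin
        cut D A∪B + k                  ≤⟨ +-monoʳ-≤ (cut D A∪B) (cut-bound D conn A∩B meet (v , cong (_∧ set B v) (avoids A))) ⟩
        cut D A∪B + cut D A∩B          ≤⟨ cut-submodular D (set A) (set B) ⟩
        cut D (set A) + cut D (set B)  ≤⟨ +-mono-≤ (small A) (small B) ⟩
        k + k                          ∎)
    }
    where
    open ≤-Reasoning
    A∪B A∩B : Fin n → Bool
    A∪B w = set A w ∨ set B w
    A∩B w = set A w ∧ set B w

  ⋃ : List Tight → Fin n → Bool
  ⋃ [] w = false
  ⋃ (X ∷ Xs) w = set X w ∨ ⋃ Xs w

  ⋃-avoids : ∀ Xs → ⋃ Xs v ≡ false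
  ⋃-avoids [] = refl
  ⋃-avoids (X ∷ Xs) = cong₂ _∨_ (avoids X) (⋃-avoids Xs)

  split-meeting : ∀ A Xs →
      (∃ λ B → ∃ λ rest → Meet A B × length rest < length Xs × (∀ w → ⋃ Xs w ≡ set B w ∨ ⋃ rest w))
    ⊎ (∀ w → set A w ∧ ⋃ Xs w ≡ false)
  split-meeting A [] = inj₂ (λ w → ∧-zeroʳ (set A w))
  split-meeting A (B ∷ Xs) with existsᵇ (λ w → set A w ∧ set B w) in meets
  ... | true = inj₁ (B , Xs , existsᵇ-sound _ meets , ≤-refl , λ w → refl)
  ... | false with split-meeting A Xs
  ...   | inj₁ (C , rest , meet , shorter , regroup) =
          inj₁ (C , B ∷ rest , meet , s≤s shorter ,
                λ w → trans (cong (set B w ∨_) (regroup w)) (∨-left-comm (set B w) (set C w) (⋃ rest w)))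
  ...   | inj₂ disjoint =
          inj₂ (λ w → trans (∧-distribˡ-∨ (set A w) (set B w) (⋃ Xs w))
                            (cong₂ _∨_ (existsᵇ-false (λ w → set A w ∧ set B w) meets w) (disjoint w)))

  -- Any union of tight sets still has no more out-degree in D than in D′:
  -- merge intersecting members until the members are disjoint.  The number
  -- N bounds the length of the list and decreases with every merge.
  union-excess : ∀ N Xs → length Xs ≤ N → tailsIn D (⋃ Xs) ≤ tailsIn D′ (⋃ Xs)
  union-excess _ [] _ = ≤-refl
  union-excess (suc N) (A ∷ Xs) (s≤s len≤N) with split-meeting A Xs
  ... | inj₁ (B , rest , meet , shorter , regroup) =
        subst₂ _≤_ (tailsIn-cong D merged) (tailsIn-cong D′ merged)
          (union-excess N (tight-union A B meet ∷ rest) (≤-trans shorter len≤N))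
    where
    merged : ∀ w → ⋃ (tight-union A B meet ∷ rest) w ≡ ⋃ (A ∷ Xs) w
    merged w = trans (∨-assoc (set A w) (set B w) (⋃ rest w)) (cong (set A w ∨_) (sym (regroup w)))
  ... | inj₂ disjoint = begin
      tailsIn D (⋃ (A ∷ Xs))                  ≡⟨ tailsIn-disjoint D (set A) (⋃ Xs) disjoint ⟩
      tailsIn D (set A) + tailsIn D (⋃ Xs)    ≤⟨ +-mono-≤ (tight-excess A) (union-excess N Xs len≤N) ⟩
      tailsIn D′ (set A) + tailsIn D′ (⋃ Xs)  ≡⟨ tailsIn-disjoint D′ (set A) (⋃ Xs) disjoint ⟨
      tailsIn D′ (⋃ (A ∷ Xs))                 ∎
    where open ≤-Reasoning

  Surplus : Fin n → Set
  Surplus u = outdeg D′ u < outdeg D u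

  -- By Menger, every surplus vertex is flippable to v or lies in a tight set;
  -- collect tight sets covering the surplus vertices of a list.
  cover : ∀ us → (∃ λ u → Surplus u × λ> D u v k)
               ⊎ (Σ (List Tight) λ Xs → ∀ u → u ∈ us → Surplus u → ⋃ Xs u ≡ true)
  cover [] = inj₂ ([] , λ _ ())
  cover (u ∷ us) with cover us
  ... | inj₁ found = inj₁ found
  ... | inj₂ (Xs , covers) with outdeg D′ u <? outdeg D u
  ...   | no ¬surplus = inj₂ (Xs , λ { _ (here refl) surplus → ⊥-elim (¬surplus surplus)
                                     ; w (there w∈us) → covers w w∈us })
  ...   | yes surplus with menger G k o u v
  ...     | inj₁ paths = inj₁ (u , surplus , paths)
  ...     | inj₂ (R , Ru , Rv , small) =
              inj₂ (X ∷ Xs , λ { _ (here refl) _ → cong (_∨ ⋃ Xs u) Ru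
                               ; w (there w∈us) s → trans (cong (R w ∨_) (covers w w∈us s)) (∨-zeroʳ (R w)) })
    where
    X : Tight
    X = record { set = R ; avoids = Rv ; member = u , Ru ; small = small }

  -- A deficit at v rules out covering all surplus vertices by tight sets:
  -- D and D′ have the same number m of arcs, but D would have no more
  -- out-degree on the union U and strictly less on its complement ∋ v.
  no-cover : outdeg D v < outdeg D′ v → ∀ Xs → (∀ u → Surplus u → ⋃ Xs u ≡ true) → ⊥
  no-cover deficit Xs covers = <-irrefl refl (begin-strict
      tailsIn D (λ _ → true)        ≡⟨ whole D ⟩
      tailsIn D U + tailsIn D U°    <⟨ +-mono-≤-< (union-excess (length Xs) Xs ≤-refl) outside ⟩
      tailsIn D′ U + tailsIn D′ U°  ≡⟨ whole D′ ⟨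
      tailsIn D′ (λ _ → true)       ∎)
    where
    open ≤-Reasoning
    U U° : Fin n → Bool
    U = ⋃ Xs
    U° = not ∘ U
    whole : ∀ D″ → tailsIn D″ (λ _ → true) ≡ tailsIn D″ U + tailsIn D″ U°
    whole D″ = trans (tailsIn-cong D″ (λ w → sym (∨-inverseʳ (U w)))) (tailsIn-disjoint D″ U U° (λ w → ∧-inverseʳ (U w)))
    pointwise : ∀ w → (if U° w then outdeg D w else 0) ≤ (if U° w then outdeg D′ w else 0)
    pointwise w with U w in Uw
    ... | true = z≤n
    ... | false = ≮⇒≥ (λ surplus → case trans (sym (covers w surplus)) Uw of λ ())
    at-v : (if U° v then outdeg D v else 0) < (if U° v then outdeg D′ v else 0)
    at-v rewrite ⋃-avoids Xs = deficit
    outside : tailsIn D U° < tailsIn D′ U°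
    outside = subst₂ _<_ (sym (degree-sum D U°)) (sym (degree-sum D′ U°)) (sum-mono-< pointwise v at-v)

  exchange : outdeg D v < outdeg D′ v → ∃ λ u → Surplus u × Flippable k D u v
  exchange deficit with cover (allFin n)
  ... | inj₁ (u , surplus , paths) = u , surplus , (λ { refl → <-asym surplus deficit }) , paths
  ... | inj₂ (Xs , covers) = ⊥-elim (no-cover deficit Xs (λ u → covers u (∈-allFin u)))

lemma6 : ∀ {n m} (k : ℕ) (G : Multigraph n m) (o o′ : Orientation G) →
    KConnected k (orient G o) → KConnected k (orient G o′) →
    ∀ (v : Fin n) → δ⁺ᵥ (orient G o) v < δ⁺ᵥ (orient G o′) v →
    ∃ λ (u : Fin n) → δ⁺ᵥ (orient G o) u > δ⁺ᵥ (orient G o′) u × Flippable k (orient G o) u v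
lemma6 k G o o′ conn conn′ v deficit
  with Exchange.exchange k G o o′ conn conn′ v (subst₂ _<_ (δ⁺ᵥ-outdeg G o v) (δ⁺ᵥ-outdeg G o′ v) deficit)
... | u , surplus , flippable =
      u , subst₂ _<_ (sym (δ⁺ᵥ-outdeg G o′ u)) (sym (δ⁺ᵥ-outdeg G o u)) surplus , flippable
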